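{- Let $a,b$ be integers with $0<a<b$ and $\gcd(a,b)=1$. Write $\frac{a}{b}=[0,a_1,\ldots,a_n]$ as a regular continued fraction with all partial quotients $a_1,\ldots,a_n$ positive integers and with $n$ odd. Let $a^*$ be the integer with $0<a^*<b$ and $aa^*\equiv 1 \pmod b$, and let $k$ be the positive integer with $aa^*=1+kb$. Define $T(a,b)=\sum_{j=1}^n(-1)^{j-1}a_j$ and $D(a,b)=\sum_{j=1}^n a_j$. Then: (1) If $a\equiv 1 \pmod 4$ or $a^*\equiv 1\pmod 4$, then $T(a,b)\equiv b-k \pmod 4$. (2) If $a\equiv 3 \pmod 4$ or $a^*\equiv 3\pmod 4$, then $T(a,b)\equiv 2+k-b \pmod 4$. (3) If $a\equiv 2 \pmod 4$ or $a^*\equiv 2\pmod 4$, then $b-k$ is even and $D(a,b)\equiv (b-k)/2 \pmod 2$.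
   Context: The requirement that $n$ be odd (rather than $a_n\ge 2$) makes the expansion unique: if the usual expansion has even length with last quotient $a_n\ge2$, one uses $[0,a_1,\ldots,a_n-1,1]$; if it has even length with $a_n=1$, one uses $[0,a_1,\ldots,a_{n-1}+1]$. -}

module Defs where

open import Data.Nat using (ℕ; zero; suc; _+_; _*_)
open import Data.Integer as ℤ using (ℤ; +_; -_)
open import Data.Integer.Divisibility using (_∣_)
open import Data.List using (List; []; _∷_)
open import Data.Product using (_×_; _,_)

-- Value of the regular continued fraction [0, a₁, …, aₙ] as a pair
-- (numerator , denominator):  [0] = 0/1 and
-- [0, a₁, a₂, …] = 1 / (a₁ + [0, a₂, …]) = q / (a₁ q + p)  when [0,a₂,…] = p/q.
cf : List ℕ → ℕ × ℕ
cf [] = 0 , 1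
cf (x ∷ xs) with cf xs
... | p , q = q , x * q + p

_/_≡cf_ : ℕ → ℕ → List ℕ → Set
a / b ≡cf xs with cf xs
... | p , q = a * q ≡ p * b
  where open import Relation.Binary.PropositionalEquality using (_≡_)

altSum : List ℕ → ℤ
altSum [] = + 0
altSum (x ∷ xs) = + x ℤ.- altSum xs

sumCF : List ℕ → ℕ
sumCF [] = 0
sumCF (x ∷ xs) = x + sumCF xs

_≡_[mod_] : ℤ → ℤ → ℕ → Set
x ≡ y [mod m ] = (+ m) ∣ (x ℤ.- y)

-- Expand a / b = [0, a₁, …, aₙ] into the product of the matrices [[aⱼ, 1], [1, 0]].  For n odd
-- its determinant is −1 and its first column is (b, a); as a / b is in lowest terms and a* is the
-- inverse of a modulo b, the product is [[b, a*], [a, k]].  Prepending a quotient x multiplies the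
-- matrix on the left and turns the alternating sum T into x − T, and T mod 4 turns out to be a
-- polynomial function χ of the matrix mod 4 (one for each determinant).  Each claim thereby becomes
-- a finite check over the residue matrices mod 4 with a a* ≡ 1 + k b, using D ≡ T (mod 2) for (3).
module Submission where

open import Defs
open import Data.Nat using (ℕ; _+_; _*_; _<_; _≤_; _%_)
open import Data.Nat.GCD using (gcd)
open import Data.Integer as ℤ using (ℤ; +_)
open import Data.List using (List; length)
open import Data.List.Relation.Unary.All using (All)
open import Data.Product using (_×_; Σ)
open import Data.Sum using (_⊎_)
open import Relation.Binary.PropositionalEquality using (_≡_)

open import Data.Nat using (suc; _∸_; _/_; _≟_; NonZero; >-nonZero; z≤n; z<s; parity)
open import Data.Nat.Properties
open import Data.Nat.DivMod using (m≡m%n+[m/n]*n; m%n<n; m%n%n≡m%n; m<n⇒m%n≡m; m*n%n≡0; %-distribˡ-+; %-distribˡ-*; %-remove-+ˡ)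
import Data.Nat.Divisibility as ℕ∣
open import Data.Nat.Divisibility using (divides; ∣m⇒∣m*n; ∣n⇒∣m*n; n∣m*n; ∣m+n∣m⇒∣n; ∣1⇒≡1; ∣-antisym; n∣m⇒m%n≡0)
open import Data.Nat.Coprimality as Coprime using (Coprime; coprime-divisor; gcd≡1⇒coprime)
import Data.Nat.Tactic.RingSolver as ℕ-Solver
open import Data.Integer.Properties using (pos-+; pos-*; ∣i*j∣≡∣i∣*∣j∣; ∣i-j∣≡∣j-i∣; [+m]-[+n]≡m⊖n; ⊖-≥; +-inverseʳ)
import Data.Integer.Divisibility.Signed as ℤ∣
import Data.Integer.Tactic.RingSolver as ℤ-Solver
open import Data.Fin using (Fin; toℕ; fromℕ<)
open import Data.Fin.Properties using (all?; toℕ-fromℕ<)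
open import Data.Parity.Base using (Parity; 0ℙ; 1ℙ; _⁻¹)
open import Data.Parity.Properties using (suc-homo-⁻¹; ⁻¹-selfInverse)
open import Data.List using ([]; _∷_)
open import Data.List.Relation.Unary.All using ([]; _∷_)
open import Data.Product using (_,_; proj₁; proj₂)
open import Data.Sum using (inj₁; inj₂)
open import Relation.Nullary.Decidable using (Dec; from-yes; _→-dec_; _⊎-dec_)
open import Relation.Binary.Bundles using (Setoid)
import Relation.Binary.Reasoning.Setoid as SetoidReasoning
open import Relation.Binary.PropositionalEquality
  using (_≢_; refl; sym; trans; cong; cong₂; subst; subst₂; module ≡-Reasoning)

-- Congruences of integers

+[m+n]-+n≡+m : ∀ m n → + (m + n) ℤ.- + n ≡ + m
+[m+n]-+n≡+m m n = trans (cong (ℤ._- + n) (pos-+ m n)) (cancel (+ m) (+ n))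
  where
  cancel : ∀ x y → x ℤ.+ y ℤ.- y ≡ x
  cancel = ℤ-Solver.solve-∀

+[m+n]-+m≡+n : ∀ m n → + (m + n) ℤ.- + m ≡ + n
+[m+n]-+m≡+n m n = trans (cong (λ z → + z ℤ.- + m) (+-comm m n)) (+[m+n]-+n≡+m n m)

-- x ≡ y [mod n ] unfolds to n dividing ∣ x - y ∣, from which unification cannot recover x and y,
-- so these lemmas take them explicitly.
module _ {n : ℕ} where

  private
    signed : ∀ x y → x ≡ y [mod n ] → (+ n) ℤ∣.∣ (x ℤ.- y)
    signed x y = ℤ∣.∣ᵤ⇒∣ {+ n} {x ℤ.- y}

    unsigned : ∀ x y → (+ n) ℤ∣.∣ (x ℤ.- y) → x ≡ y [mod n ]
    unsigned x y = ℤ∣.∣⇒∣ᵤ {+ n} {x ℤ.- y}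

    rearranged : ∀ x y {z} → z ≡ x ℤ.- y → (+ n) ℤ∣.∣ z → x ≡ y [mod n ]
    rearranged x y eq d = unsigned x y (subst ((+ n) ℤ∣.∣_) eq d)

  ≡[mod]-refl : ∀ x → x ≡ x [mod n ]
  ≡[mod]-refl x = unsigned x x (ℤ∣.divides (+ 0) (+-inverseʳ x))

  ≡[mod]-sym : ∀ x y → x ≡ y [mod n ] → y ≡ x [mod n ]
  ≡[mod]-sym x y = subst (n ℕ∣.∣_) (∣i-j∣≡∣j-i∣ x y)

  ≡[mod]-trans : ∀ x y z → x ≡ y [mod n ] → y ≡ z [mod n ] → x ≡ z [mod n ]
  ≡[mod]-trans x y z p q =
    rearranged x z (telescope x y z) (ℤ∣.∣m∣n⇒∣m+n (signed x y p) (signed y z q))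
    where
    telescope : ∀ x y z → (x ℤ.- y) ℤ.+ (y ℤ.- z) ≡ x ℤ.- z
    telescope = ℤ-Solver.solve-∀

  +-cong-≡[mod] : ∀ x x′ y y′ → x ≡ x′ [mod n ] → y ≡ y′ [mod n ] → (x ℤ.+ y) ≡ (x′ ℤ.+ y′) [mod n ]
  +-cong-≡[mod] x x′ y y′ p q =
    rearranged (x ℤ.+ y) (x′ ℤ.+ y′) (interchange x x′ y y′) (ℤ∣.∣m∣n⇒∣m+n (signed x x′ p) (signed y y′ q))
    where
    interchange : ∀ x x′ y y′ → (x ℤ.- x′) ℤ.+ (y ℤ.- y′) ≡ (x ℤ.+ y) ℤ.- (x′ ℤ.+ y′)
    interchange = ℤ-Solver.solve-∀

  -‿cong-≡[mod] : ∀ x y → x ≡ y [mod n ] → (ℤ.- x) ≡ (ℤ.- y) [mod n ]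
  -‿cong-≡[mod] x y p = rearranged (ℤ.- x) (ℤ.- y) (negate x y) (ℤ∣.∣m⇒∣-m (signed x y p))
    where
    negate : ∀ x y → ℤ.- (x ℤ.- y) ≡ ℤ.- x ℤ.- ℤ.- y
    negate = ℤ-Solver.solve-∀

  −-cong-≡[mod] : ∀ x x′ y y′ → x ≡ x′ [mod n ] → y ≡ y′ [mod n ] → (x ℤ.- y) ≡ (x′ ℤ.- y′) [mod n ]
  −-cong-≡[mod] x x′ y y′ p q = +-cong-≡[mod] x x′ (ℤ.- y) (ℤ.- y′) p (-‿cong-≡[mod] y y′ q)

  ≡[mod]-setoid : Setoid _ _
  ≡[mod]-setoid = record
    { _≈_ = λ x y → x ≡ y [mod n ]
    ; isEquivalence = record
      { refl = λ {x} → ≡[mod]-refl x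
      ; sym = λ {x} {y} → ≡[mod]-sym x y
      ; trans = λ {x} {y} {z} → ≡[mod]-trans x y z
      }
    }

  ≡[mod]-weaken : ∀ {m} x y → m ℕ∣.∣ n → x ≡ y [mod n ] → x ≡ y [mod m ]
  ≡[mod]-weaken x y m∣n p = ℕ∣.∣-trans m∣n p

  *-cancelˡ-≡[mod] : ∀ c u v .{{_ : NonZero c}} → (+ (c * u)) ≡ (+ (c * v)) [mod c * n ] → (+ u) ≡ (+ v) [mod n ]
  *-cancelˡ-≡[mod] c u v p = ℕ∣.*-cancelˡ-∣ c (subst (c * n ℕ∣.∣_) factor p)
    where
    factor : ℤ.∣ + (c * u) ℤ.- + (c * v) ∣ ≡ c * ℤ.∣ + u ℤ.- + v ∣
    factor = begin
      ℤ.∣ + (c * u) ℤ.- + (c * v) ∣        ≡⟨ cong ℤ.∣_∣ (cong₂ ℤ._-_ (pos-* c u) (pos-* c v)) ⟩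
      ℤ.∣ + c ℤ.* + u ℤ.- + c ℤ.* + v ∣    ≡⟨ cong ℤ.∣_∣ (distrib (+ c) (+ u) (+ v)) ⟩
      ℤ.∣ + c ℤ.* (+ u ℤ.- + v) ∣          ≡⟨ ∣i*j∣≡∣i∣*∣j∣ (+ c) (+ u ℤ.- + v) ⟩
      c * ℤ.∣ + u ℤ.- + v ∣                ∎
      where
      open ≡-Reasoning
      distrib : ∀ c x y → c ℤ.* x ℤ.- c ℤ.* y ≡ c ℤ.* (x ℤ.- y)
      distrib = ℤ-Solver.solve-∀

  module _ .{{_ : NonZero n}} where

    %-≡[mod] : ∀ u → (+ (u % n)) ≡ (+ u) [mod n ]
    %-≡[mod] u = ≡[mod]-sym (+ u) (+ (u % n)) (rearranged (+ u) (+ (u % n)) eq (ℤ∣.divides (+ (u / n)) refl))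
      where
      eq : + (u / n) ℤ.* + n ≡ + u ℤ.- + (u % n)
      eq = begin
        + (u / n) ℤ.* + n                    ≡⟨ pos-* (u / n) n ⟨
        + (u / n * n)                        ≡⟨ +[m+n]-+n≡+m (u / n * n) (u % n) ⟨
        + (u / n * n + u % n) ℤ.- + (u % n)  ≡⟨ cong (λ m → + m ℤ.- + (u % n)) u≡[u/n]*n+u%n ⟨
        + u ℤ.- + (u % n)                    ∎
        where
        open ≡-Reasoning
        u≡[u/n]*n+u%n : u ≡ u / n * n + u % n
        u≡[u/n]*n+u%n = trans (m≡m%n+[m/n]*n u n) (+-comm (u % n) (u / n * n))

    %≡%⇒≡[mod] : ∀ u v → u % n ≡ v % n → (+ u) ≡ (+ v) [mod n ]
    %≡%⇒≡[mod] u v eq = ≡[mod]-trans (+ u) (+ (v % n)) (+ v)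
      (subst (λ r → (+ u) ≡ (+ r) [mod n ]) eq (≡[mod]-sym (+ (u % n)) (+ u) (%-≡[mod] u)))
      (%-≡[mod] v)

    private
      ≤⇒≡[mod]⇒%≡% : ∀ u v → v ≤ u → (+ u) ≡ (+ v) [mod n ] → u % n ≡ v % n
      ≤⇒≡[mod]⇒%≡% u v v≤u p = begin
        u % n            ≡⟨ cong (_% n) (m∸n+n≡m v≤u) ⟨
        (u ∸ v + v) % n  ≡⟨ %-remove-+ˡ v n∣u∸v ⟩
        v % n            ∎
        where
        open ≡-Reasoning
        n∣u∸v : n ℕ∣.∣ (u ∸ v)
        n∣u∸v = subst (n ℕ∣.∣_) (cong ℤ.∣_∣ (trans ([+m]-[+n]≡m⊖n u v) (⊖-≥ v≤u))) p

    ≡[mod]⇒%≡% : ∀ u v → (+ u) ≡ (+ v) [mod n ] → u % n ≡ v % n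
    ≡[mod]⇒%≡% u v p with ≤-total v u
    ... | inj₁ v≤u = ≤⇒≡[mod]⇒%≡% u v v≤u p
    ... | inj₂ u≤v = sym (≤⇒≡[mod]⇒%≡% v u u≤v (≡[mod]-sym (+ u) (+ v) p))

x≡-x[mod2] : ∀ x → x ≡ (ℤ.- x) [mod 2 ]
x≡-x[mod2] x = ℤ∣.∣⇒∣ᵤ {+ 2} {x ℤ.- ℤ.- x} (ℤ∣.divides x (double x))
  where
  double : ∀ x → x ℤ.- ℤ.- x ≡ x ℤ.* + 2
  double = ℤ-Solver.solve-∀

-- Continuant matrices

record Mat : Set where
  constructor mat
  field A B C D : ℕ
open Mat

-- The product [[x, 1], [1, 0]] · [[A, B], [C, D]].
infixr 5 _◃_
_◃_ : ℕ → Mat → Mat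
x ◃ mat A B C D = mat (x * A + C) (x * B + D) A B

continuant : List ℕ → Mat
continuant []       = mat 1 0 0 1
continuant (x ∷ xs) = x ◃ continuant xs

cf≡continuant : ∀ xs → cf xs ≡ (C (continuant xs) , A (continuant xs))
cf≡continuant []       = refl
cf≡continuant (x ∷ xs) rewrite cf≡continuant xs = refl

≡cf⇒cross : ∀ a b xs → a / b ≡cf xs → a * A (continuant xs) ≡ C (continuant xs) * b
≡cf⇒cross a b xs eq with cf xs | cf≡continuant xs
... | _ | refl = eq

-- det M = (−1)ᵖ, written without subtraction.
Unimodular : Parity → Mat → Set
Unimodular 0ℙ (mat A B C D) = A * D ≡ B * C + 1
Unimodular 1ℙ (mat A B C D) = B * C ≡ A * D + 1

◃-unimodular : ∀ x p M → Unimodular p M → Unimodular (p ⁻¹) (x ◃ M)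
◃-unimodular x 0ℙ (mat A B C D) AD≡BC+1 = begin
  (x * B + D) * A          ≡⟨ expand x B A D ⟩
  x * A * B + A * D        ≡⟨ cong (λ z → x * A * B + z) AD≡BC+1 ⟩
  x * A * B + (B * C + 1)  ≡⟨ collect x A B C ⟩
  (x * A + C) * B + 1      ∎
  where
  open ≡-Reasoning
  expand : ∀ x u v w → (x * u + w) * v ≡ x * v * u + v * w
  expand = ℕ-Solver.solve-∀
  collect : ∀ x u v w → x * u * v + (v * w + 1) ≡ (x * u + w) * v + 1
  collect = ℕ-Solver.solve-∀
◃-unimodular x 1ℙ (mat A B C D) BC≡AD+1 = begin
  (x * A + C) * B          ≡⟨ expand x A B C ⟩
  x * A * B + B * C        ≡⟨ cong (λ z → x * A * B + z) BC≡AD+1 ⟩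
  x * A * B + (A * D + 1)  ≡⟨ collect x A B D ⟩
  (x * B + D) * A + 1      ∎
  where
  open ≡-Reasoning
  expand : ∀ x u v w → (x * u + w) * v ≡ x * u * v + v * w
  expand = ℕ-Solver.solve-∀
  collect : ∀ x u v w → x * u * v + (u * w + 1) ≡ (x * v + w) * u + 1
  collect = ℕ-Solver.solve-∀

parity-suc : ∀ n → parity (suc n) ≡ parity n ⁻¹
parity-suc n = sym (⁻¹-selfInverse (suc-homo-⁻¹ n))

continuant-unimodular : ∀ xs → Unimodular (parity (length xs)) (continuant xs)
continuant-unimodular []       = refl
continuant-unimodular (x ∷ xs) rewrite parity-suc (length xs) =
  ◃-unimodular x (parity (length xs)) (continuant xs) (continuant-unimodular xs)

%2≡1⇒parity≡1ℙ : ∀ n → n % 2 ≡ 1 → parity n ≡ 1ℙ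
%2≡1⇒parity≡1ℙ 1             _ = refl
%2≡1⇒parity≡1ℙ (suc (suc n)) h = %2≡1⇒parity≡1ℙ n h

∣n+1∧∣n⇒≡1 : ∀ {d n} → d ℕ∣.∣ n + 1 → d ℕ∣.∣ n → d ≡ 1
∣n+1∧∣n⇒≡1 d∣n+1 d∣n = ∣1⇒≡1 (∣m+n∣m⇒∣n d∣n+1 d∣n)

unimodular⇒coprime : ∀ p M → Unimodular p M → Coprime (C M) (A M)
unimodular⇒coprime 0ℙ (mat A B C D) AD≡BC+1 {d} (d∣C , d∣A) =
  ∣n+1∧∣n⇒≡1 (subst (d ℕ∣.∣_) AD≡BC+1 (∣m⇒∣m*n D d∣A)) (∣n⇒∣m*n B d∣C)
unimodular⇒coprime 1ℙ (mat A B C D) BC≡AD+1 {d} (d∣C , d∣A) =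
  ∣n+1∧∣n⇒≡1 (subst (d ℕ∣.∣_) BC≡AD+1 (∣n⇒∣m*n B d∣C)) (∣m⇒∣m*n D d∣A)

coprime-cross-unique : ∀ {a b c d} .{{_ : NonZero b}} → Coprime a b → Coprime c d →
                       a * d ≡ c * b → a ≡ c × b ≡ d
coprime-cross-unique {a} {b} {c} {d} cop-ab cop-cd ad≡cb = a≡c , b≡d
  where
  b∣d : b ℕ∣.∣ d
  b∣d = coprime-divisor (Coprime.sym cop-ab) (divides c ad≡cb)
  d∣b : d ℕ∣.∣ b
  d∣b = coprime-divisor (Coprime.sym cop-cd) (divides a (sym ad≡cb))
  b≡d : b ≡ d
  b≡d = ∣-antisym b∣d d∣b
  a≡c : a ≡ c
  a≡c = *-cancelʳ-≡ a c b (subst (λ z → a * z ≡ c * b) (sym b≡d) ad≡cb)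

≤-inverse-unique : ∀ {n a u v s t} .{{_ : NonZero n}} → Coprime n a →
                   a * u ≡ 1 + s * n → a * v ≡ 1 + t * n → u ≤ v → v < n → u ≡ v
≤-inverse-unique {n} {a} {u} {v} {s} {t} cop au≡ av≡ u≤v v<n =
  ≤-antisym u≤v (m∸n≡0⇒m≤n v∸u≡0)
  where
  a[v∸u]≡[t∸s]n : a * (v ∸ u) ≡ (t ∸ s) * n
  a[v∸u]≡[t∸s]n = begin
    a * (v ∸ u)                ≡⟨ *-distribˡ-∸ a v u ⟩
    a * v ∸ a * u              ≡⟨ cong₂ _∸_ av≡ au≡ ⟩
    (1 + t * n) ∸ (1 + s * n)  ≡⟨ *-distribʳ-∸ n t s ⟨
    (t ∸ s) * n                ∎
    where open ≡-Reasoning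
  v∸u≡0 : v ∸ u ≡ 0
  v∸u≡0 = trans (sym (m<n⇒m%n≡m (≤-<-trans (m∸n≤m v u) v<n)))
                (n∣m⇒m%n≡0 (v ∸ u) n (coprime-divisor cop (divides (t ∸ s) a[v∸u]≡[t∸s]n)))

inverse-unique : ∀ {n a u v s t} .{{_ : NonZero n}} → Coprime n a →
                 a * u ≡ 1 + s * n → a * v ≡ 1 + t * n → u < n → v < n → u ≡ v
inverse-unique {u = u} {v} {s} {t} cop au≡ av≡ u<n v<n with ≤-total u v
... | inj₁ u≤v = ≤-inverse-unique {s = s} {t} cop au≡ av≡ u≤v v<n
... | inj₂ v≤u = sym (≤-inverse-unique {s = t} {s} cop av≡ au≡ v≤u u<n)

inverse-< : ∀ {n a u s} → 1 < n → u ≤ n → a * u ≡ 1 + s * n → u < n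
inverse-< {n} {a} {u} {s} 1<n u≤n au≡1+sn = ≤∧≢⇒< u≤n u≢n
  where
  u≢n : u ≢ n
  u≢n refl = <-irrefl (sym n≡1) 1<n
    where
    n≡1 : n ≡ 1
    n≡1 = ∣n+1∧∣n⇒≡1 (subst (n ℕ∣.∣_) (trans au≡1+sn (+-comm 1 (s * n))) (n∣m*n a)) (n∣m*n s)

inverse-quotient-< : ∀ {n a u k} → a < n → u < n → a * u ≡ 1 + k * n → k < n
inverse-quotient-< {n} {a} {u} {k} a<n u<n au≡1+kn = *-cancelʳ-< n k n (begin-strict
  k * n      <⟨ n<1+n (k * n) ⟩
  1 + k * n  ≡⟨ au≡1+kn ⟨
  a * u      <⟨ *-mono-< a<n u<n ⟩
  n * n      ∎)
  where open ≤-Reasoning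

continuant-B≤A×D≤C : ∀ x xs → All (1 ≤_) (x ∷ xs) →
                     let M = continuant (x ∷ xs) in B M ≤ A M × D M ≤ C M
continuant-B≤A×D≤C x []       (1≤x ∷ []) rewrite *-zeroʳ x | *-identityʳ x | +-identityʳ x = 1≤x , z≤n
continuant-B≤A×D≤C x (y ∷ xs) (_ ∷ ys) with continuant-B≤A×D≤C y xs ys
... | B≤A , D≤C = +-mono-≤ (*-monoʳ-≤ x B≤A) D≤C , B≤A

mat-cong : ∀ {A B C D A′ B′ C′ D′} → A ≡ A′ → B ≡ B′ → C ≡ C′ → D ≡ D′ → mat A B C D ≡ mat A′ B′ C′ D′
mat-cong refl refl refl refl = refl

odd-continuant : ∀ {a b a* k} x xs → 1 < b → gcd a b ≡ 1 → All (1 ≤_) (x ∷ xs) →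
                 length (x ∷ xs) % 2 ≡ 1 → a / b ≡cf (x ∷ xs) →
                 a* < b → a * a* ≡ 1 + k * b → continuant (x ∷ xs) ≡ mat b a* a k
odd-continuant {a} {b} {a*} {k} x xs 1<b gcd≡1 positive odd a/b a*<b aa*≡1+kb =
  mat-cong (sym b≡A) (sym a*≡B) (sym a≡C) (sym k≡D)
  where
  instance
    _ : NonZero b
    _ = >-nonZero (<-trans z<s 1<b)
  M = continuant (x ∷ xs)
  unimodular : B M * C M ≡ A M * D M + 1
  unimodular = subst (λ p → Unimodular p M) (%2≡1⇒parity≡1ℙ (length (x ∷ xs)) odd) (continuant-unimodular (x ∷ xs))
  coprime-ab : Coprime a b
  coprime-ab = gcd≡1⇒coprime gcd≡1
  a≡C×b≡A : a ≡ C M × b ≡ A M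
  a≡C×b≡A = coprime-cross-unique coprime-ab (unimodular⇒coprime 1ℙ M unimodular) (≡cf⇒cross a b (x ∷ xs) a/b)
  a≡C = proj₁ a≡C×b≡A
  b≡A = proj₂ a≡C×b≡A
  aB≡1+Db : a * B M ≡ 1 + D M * b
  aB≡1+Db = begin
    a * B M          ≡⟨ *-comm a (B M) ⟩
    B M * a          ≡⟨ cong (B M *_) a≡C ⟩
    B M * C M        ≡⟨ unimodular ⟩
    A M * D M + 1    ≡⟨ cong (λ z → z * D M + 1) b≡A ⟨
    b * D M + 1      ≡⟨ +-comm (b * D M) 1 ⟩
    1 + b * D M      ≡⟨ cong (λ z → 1 + z) (*-comm b (D M)) ⟩
    1 + D M * b      ∎
    where open ≡-Reasoning
  B<b : B M < b
  B<b = inverse-< {a = a} {s = D M} 1<b (subst (B M ≤_) (sym b≡A) (proj₁ (continuant-B≤A×D≤C x xs positive))) aB≡1+Db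
  a*≡B : a* ≡ B M
  a*≡B = inverse-unique {s = k} {D M} (Coprime.sym coprime-ab) aa*≡1+kb aB≡1+Db a*<b B<b
  k≡D : k ≡ D M
  k≡D = *-cancelʳ-≡ k (D M) b (suc-injective (trans (sym aa*≡1+kb) (trans (cong (a *_) a*≡B) aB≡1+Db)))

-- Reduction modulo 4

mod4 : Mat → Mat
mod4 (mat A B C D) = mat (A % 4) (B % 4) (C % 4) (D % 4)

%-distribˡ-*+ : ∀ x a c n .{{_ : NonZero n}} → (x * a + c) % n ≡ (x % n * (a % n) + c % n) % n
%-distribˡ-*+ x a c n = begin
  (x * a + c) % n                          ≡⟨ %-distribˡ-+ (x * a) c n ⟩
  ((x * a) % n + c % n) % n                ≡⟨ cong (λ z → (z + c % n) % n) (%-distribˡ-* x a n) ⟩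
  ((x % n * (a % n)) % n + c % n) % n      ≡⟨ cong (λ z → ((x % n * (a % n)) % n + z) % n) (m%n%n≡m%n c n) ⟨
  ((x % n * (a % n)) % n + c % n % n) % n  ≡⟨ %-distribˡ-+ (x % n * (a % n)) (c % n) n ⟨
  (x % n * (a % n) + c % n) % n            ∎
  where open ≡-Reasoning

◃-mod4 : ∀ x M → mod4 (x ◃ M) ≡ mod4 (x % 4 ◃ mod4 M)
◃-mod4 x (mat A B C D) =
  mat-cong (%-distribˡ-*+ x A C 4) (%-distribˡ-*+ x B D 4) (sym (m%n%n≡m%n A 4)) (sym (m%n%n≡m%n B 4))

Unimodular₄ : Parity → Mat → Set
Unimodular₄ 0ℙ (mat A B C D) = (A * D) % 4 ≡ (B * C + 1) % 4
Unimodular₄ 1ℙ (mat A B C D) = (B * C) % 4 ≡ (A * D + 1) % 4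

unimodular₄? : ∀ p M → Dec (Unimodular₄ p M)
unimodular₄? 0ℙ (mat A B C D) = (A * D) % 4 ≟ (B * C + 1) % 4
unimodular₄? 1ℙ (mat A B C D) = (B * C) % 4 ≟ (A * D + 1) % 4

unimodular⇒unimodular₄ : ∀ p M → Unimodular p M → Unimodular₄ p (mod4 M)
unimodular⇒unimodular₄ 0ℙ (mat A B C D) AD≡BC+1 =
  trans (sym (%-distribˡ-* A D 4)) (trans (cong (_% 4) AD≡BC+1) (%-distribˡ-*+ B C 1 4))
unimodular⇒unimodular₄ 1ℙ (mat A B C D) BC≡AD+1 =
  trans (sym (%-distribˡ-* B C 4)) (trans (cong (_% 4) BC≡AD+1) (%-distribˡ-*+ A D 1 4))

-- Found by interpolating T mod 4 over the 48 residue matrices of each determinant; all that is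
-- used is the step law checked below.
χ : Parity → Mat → ℕ
χ 0ℙ (mat A B C D) = (D + C + B * D + 3 * B * C * D + 3 * A * D + A * C + A * C * D) % 4
χ 1ℙ (mat A B C D) = (D + 3 * C + B * D + B * C + B * C * D + A * C + A * C * D) % 4

Residues : (Mat → Set) → Set
Residues P = ∀ (i j k l : Fin 4) → P (mat (toℕ i) (toℕ j) (toℕ k) (toℕ l))

residues? : {P : Mat → Set} → (∀ M → Dec (P M)) → Dec (Residues P)
residues? P? = all? λ i → all? λ j → all? λ k → all? λ l → P? _

residue : ℕ → Fin 4
residue m = fromℕ< (m%n<n m 4)

toℕ-residue : ∀ m → toℕ (residue m) ≡ m % 4
toℕ-residue m = toℕ-fromℕ< (m%n<n m 4)

residues⇒mod4 : {P : Mat → Set} → Residues P → ∀ M → P (mod4 M)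
residues⇒mod4 {P} all (mat A B C D) =
  subst P (mat-cong (toℕ-residue A) (toℕ-residue B) (toℕ-residue C) (toℕ-residue D))
    (all (residue A) (residue B) (residue C) (residue D))

StepLaw : Parity → Fin 4 → Mat → Set
StepLaw p x r = Unimodular₄ p r → (χ (p ⁻¹) (mod4 (toℕ x ◃ r)) + χ p r) % 4 ≡ toℕ x

stepLaw? : ∀ p x r → Dec (StepLaw p x r)
stepLaw? p x r = unimodular₄? p r →-dec ((χ (p ⁻¹) (mod4 (toℕ x ◃ r)) + χ p r) % 4 ≟ toℕ x)

stepLaw-residues : ∀ p x → Residues (StepLaw p x)
stepLaw-residues 0ℙ = from-yes (all? {n = 4} λ x → residues? (stepLaw? 0ℙ x))
stepLaw-residues 1ℙ = from-yes (all? {n = 4} λ x → residues? (stepLaw? 1ℙ x))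

χ-◃ : ∀ x p M → Unimodular p M → (χ (p ⁻¹) (mod4 (x ◃ M)) + χ p (mod4 M)) % 4 ≡ x % 4
χ-◃ x p M unimodular rewrite ◃-mod4 x M =
  subst (λ y → (χ (p ⁻¹) (mod4 (y ◃ mod4 M)) + χ p (mod4 M)) % 4 ≡ y) (toℕ-residue x)
    (residues⇒mod4 {StepLaw p (residue x)} (stepLaw-residues p (residue x)) M (unimodular⇒unimodular₄ p M unimodular))

altSum≡χ : ∀ xs → altSum xs ≡ + χ (parity (length xs)) (mod4 (continuant xs)) [mod 4 ]
altSum≡χ [] = ≡[mod]-refl (+ 0)
altSum≡χ (x ∷ xs) rewrite parity-suc (length xs) = begin
  + x ℤ.- altSum xs    ≈⟨ −-cong-≡[mod] (+ x) (+ x) (altSum xs) (+ c) (≡[mod]-refl (+ x)) (altSum≡χ xs) ⟩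
  + x ℤ.- + c          ≈⟨ −-cong-≡[mod] (+ x) (+ (c′ + c)) (+ c) (+ c) x≡c′+c (≡[mod]-refl (+ c)) ⟩
  + (c′ + c) ℤ.- + c   ≡⟨ +[m+n]-+n≡+m c′ c ⟩
  + c′                 ∎
  where
  open SetoidReasoning (≡[mod]-setoid {4})
  p = parity (length xs)
  M = continuant xs
  c = χ p (mod4 M)
  c′ = χ (p ⁻¹) (mod4 (x ◃ M))
  x≡c′+c : (+ x) ≡ (+ (c′ + c)) [mod 4 ]
  x≡c′+c = %≡%⇒≡[mod] x (c′ + c) (sym (χ-◃ x p M (continuant-unimodular xs)))

sumCF≡altSum : ∀ xs → (+ sumCF xs) ≡ altSum xs [mod 2 ]
sumCF≡altSum []       = ≡[mod]-refl (+ 0)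
sumCF≡altSum (x ∷ xs) =
  +-cong-≡[mod] (+ x) (+ x) (+ sumCF xs) (ℤ.- altSum xs) (≡[mod]-refl (+ x))
    (≡[mod]-trans (+ sumCF xs) (altSum xs) (ℤ.- altSum xs) (sumCF≡altSum xs) (x≡-x[mod2] (altSum xs)))

OddCase₁ OddCase₃ OddCase₂ : Mat → Set
OddCase₁ r = Unimodular₄ 1ℙ r → C r ≡ 1 ⊎ B r ≡ 1 → (χ 1ℙ r + D r) % 4 ≡ A r % 4
OddCase₃ r = Unimodular₄ 1ℙ r → C r ≡ 3 ⊎ B r ≡ 3 → (χ 1ℙ r + A r) % 4 ≡ (2 + D r) % 4
OddCase₂ r = Unimodular₄ 1ℙ r → C r ≡ 2 ⊎ B r ≡ 2 → (D r + 2 * χ 1ℙ r) % 4 ≡ A r % 4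

oddCase₁-residues : Residues OddCase₁
oddCase₁-residues = from-yes (residues? λ r → unimodular₄? 1ℙ r →-dec ((C r ≟ 1 ⊎-dec B r ≟ 1) →-dec ((χ 1ℙ r + D r) % 4 ≟ A r % 4)))

oddCase₃-residues : Residues OddCase₃
oddCase₃-residues = from-yes (residues? λ r → unimodular₄? 1ℙ r →-dec ((C r ≟ 3 ⊎-dec B r ≟ 3) →-dec ((χ 1ℙ r + A r) % 4 ≟ (2 + D r) % 4)))

oddCase₂-residues : Residues OddCase₂
oddCase₂-residues = from-yes (residues? λ r → unimodular₄? 1ℙ r →-dec ((C r ≟ 2 ⊎-dec B r ≟ 2) →-dec ((D r + 2 * χ 1ℙ r) % 4 ≟ A r % 4)))

half-difference : ∀ k b c → k ≤ b → (+ (k + 2 * c)) ≡ (+ b) [mod 4 ] →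
                  Σ ℕ λ m → (b ≡ k + 2 * m) × ((+ c) ≡ (+ m) [mod 2 ])
half-difference k b c k≤b k+2c≡b = m , b≡k+2m , *-cancelˡ-≡[mod] 2 c m (subst (λ z → (+ (2 * c)) ≡ (+ z) [mod 4 ]) d≡2m 2c≡d)
  where
  d = b ∸ k
  b≡k+d : b ≡ k + d
  b≡k+d = sym (m+[n∸m]≡n k≤b)
  2c≡d : (+ (2 * c)) ≡ (+ d) [mod 4 ]
  2c≡d = begin
    + (2 * c)                      ≡⟨ +[m+n]-+m≡+n k (2 * c) ⟨
    + (k + 2 * c) ℤ.- + k          ≈⟨ −-cong-≡[mod] (+ (k + 2 * c)) (+ b) (+ k) (+ k) k+2c≡b (≡[mod]-refl (+ k)) ⟩
    + b ℤ.- + k                    ≡⟨ cong (λ z → + z ℤ.- + k) b≡k+d ⟩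
    + (k + d) ℤ.- + k              ≡⟨ +[m+n]-+m≡+n k d ⟩
    + d                            ∎
    where open SetoidReasoning (≡[mod]-setoid {4})
  d%2≡0 : d % 2 ≡ 0
  d%2≡0 = begin
    d % 2          ≡⟨ ≡[mod]⇒%≡% (2 * c) d (≡[mod]-weaken (+ (2 * c)) (+ d) (divides 2 refl) 2c≡d) ⟨
    (2 * c) % 2    ≡⟨ cong (_% 2) (*-comm 2 c) ⟩
    (c * 2) % 2    ≡⟨ m*n%n≡0 c 2 ⟩
    0              ∎
    where open ≡-Reasoning
  m = d / 2
  d≡2m : d ≡ 2 * m
  d≡2m = trans (m≡m%n+[m/n]*n d 2) (trans (cong (_+ m * 2) d%2≡0) (*-comm m 2))
  b≡k+2m : b ≡ k + 2 * m
  b≡k+2m = trans b≡k+d (cong (λ z → k + z) d≡2m)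

module _ (T : ℤ) (b a* a k : ℕ) (unimodular : Unimodular₄ 1ℙ (mod4 (mat b a* a k)))
         (T≡χ : T ≡ (+ χ 1ℙ (mod4 (mat b a* a k))) [mod 4 ]) where

  private
    c = χ 1ℙ (mod4 (mat b a* a k))

  odd-case₁ : a % 4 ≡ 1 ⊎ a* % 4 ≡ 1 → T ≡ + b ℤ.- + k [mod 4 ]
  odd-case₁ h = begin
    T                                ≈⟨ T≡χ ⟩
    + c                              ≡⟨ +[m+n]-+n≡+m c (k % 4) ⟨
    + (c + k % 4) ℤ.- + (k % 4)      ≈⟨ −-cong-≡[mod] (+ (c + k % 4)) (+ b) (+ (k % 4)) (+ k) c+k≡b (%-≡[mod] k) ⟩
    + b ℤ.- + k                      ∎
    where
    open SetoidReasoning (≡[mod]-setoid {4})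
    c+k≡b : (+ (c + k % 4)) ≡ (+ b) [mod 4 ]
    c+k≡b = ≡[mod]-trans (+ (c + k % 4)) (+ (b % 4)) (+ b)
      (%≡%⇒≡[mod] (c + k % 4) (b % 4) (residues⇒mod4 {OddCase₁} oddCase₁-residues (mat b a* a k) unimodular h))
      (%-≡[mod] b)

  odd-case₃ : a % 4 ≡ 3 ⊎ a* % 4 ≡ 3 → T ≡ + 2 ℤ.+ + k ℤ.- + b [mod 4 ]
  odd-case₃ h = begin
    T                                ≈⟨ T≡χ ⟩
    + c                              ≡⟨ +[m+n]-+n≡+m c (b % 4) ⟨
    + (c + b % 4) ℤ.- + (b % 4)      ≈⟨ −-cong-≡[mod] (+ (c + b % 4)) (+ (2 + k)) (+ (b % 4)) (+ b) c+b≡2+k (%-≡[mod] b) ⟩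
    + (2 + k) ℤ.- + b                ∎
    where
    open SetoidReasoning (≡[mod]-setoid {4})
    c+b≡2+k : (+ (c + b % 4)) ≡ (+ (2 + k)) [mod 4 ]
    c+b≡2+k = %≡%⇒≡[mod] (c + b % 4) (2 + k)
      (trans (residues⇒mod4 {OddCase₃} oddCase₃-residues (mat b a* a k) unimodular h) (sym (%-distribˡ-+ 2 k 4)))

  odd-case₂ : ∀ S → (+ S) ≡ T [mod 2 ] → k ≤ b → a % 4 ≡ 2 ⊎ a* % 4 ≡ 2 →
              Σ ℕ λ m → (b ≡ k + 2 * m) × (S % 2 ≡ m % 2)
  odd-case₂ S S≡T k≤b h = conclude (half-difference k b c k≤b k+2c≡b)
    where
    k+2c≡b : (+ (k + 2 * c)) ≡ (+ b) [mod 4 ]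
    k+2c≡b = ≡[mod]-trans (+ (k + 2 * c)) (+ (k % 4 + 2 * c)) (+ b)
      (+-cong-≡[mod] (+ k) (+ (k % 4)) (+ (2 * c)) (+ (2 * c))
        (≡[mod]-sym (+ (k % 4)) (+ k) (%-≡[mod] k)) (≡[mod]-refl (+ (2 * c))))
      (≡[mod]-trans (+ (k % 4 + 2 * c)) (+ (b % 4)) (+ b)
        (%≡%⇒≡[mod] (k % 4 + 2 * c) (b % 4) (residues⇒mod4 {OddCase₂} oddCase₂-residues (mat b a* a k) unimodular h))
        (%-≡[mod] b))
    conclude : Σ ℕ (λ m → (b ≡ k + 2 * m) × ((+ c) ≡ (+ m) [mod 2 ])) → Σ ℕ λ m → (b ≡ k + 2 * m) × (S % 2 ≡ m % 2)
    conclude (m , b≡k+2m , c≡m) = m , b≡k+2m , ≡[mod]⇒%≡% S m S≡m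
      where
      S≡m : (+ S) ≡ (+ m) [mod 2 ]
      S≡m = ≡[mod]-trans (+ S) T (+ m) S≡T
              (≡[mod]-trans T (+ c) (+ m) (≡[mod]-weaken T (+ c) (divides 2 refl) T≡χ) c≡m)

theorem1 : (a b a* k : ℕ) (as : List ℕ) →
    0 < a → a < b → gcd a b ≡ 1 →
    All (1 ≤_) as → length as % 2 ≡ 1 → a / b ≡cf as →
    0 < a* → a* < b → a * a* ≡ 1 + k * b →
    ((a % 4 ≡ 1 ⊎ a* % 4 ≡ 1) → altSum as ≡ + b ℤ.- + k [mod 4 ])
    × ((a % 4 ≡ 3 ⊎ a* % 4 ≡ 3) → altSum as ≡ + 2 ℤ.+ + k ℤ.- + b [mod 4 ])
    × ((a % 4 ≡ 2 ⊎ a* % 4 ≡ 2) →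
        Σ ℕ λ m → (b ≡ k + 2 * m) × (sumCF as % 2 ≡ m % 2))
theorem1 a b a* k [] _ _ _ _ () _ _ _ _
theorem1 a b a* k as@(x ∷ xs) 0<a a<b gcd≡1 positive odd a/b _ a*<b aa*≡1+kb =
  odd-case₁ T b a* a k unimodular T≡χ ,
  odd-case₃ T b a* a k unimodular T≡χ ,
  odd-case₂ T b a* a k unimodular T≡χ (sumCF as) (sumCF≡altSum as) k≤b
  where
  T = altSum as
  parity≡1ℙ : parity (length as) ≡ 1ℙ
  parity≡1ℙ = %2≡1⇒parity≡1ℙ (length as) odd
  M≡ : continuant as ≡ mat b a* a k
  M≡ = odd-continuant x xs (≤-<-trans 0<a a<b) gcd≡1 positive odd a/b a*<b aa*≡1+kb
  unimodular : Unimodular₄ 1ℙ (mod4 (mat b a* a k))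
  unimodular = subst₂ (λ p M → Unimodular₄ p (mod4 M)) parity≡1ℙ M≡
                 (unimodular⇒unimodular₄ _ _ (continuant-unimodular as))
  T≡χ : T ≡ (+ χ 1ℙ (mod4 (mat b a* a k))) [mod 4 ]
  T≡χ = subst₂ (λ p M → T ≡ (+ χ p (mod4 M)) [mod 4 ]) parity≡1ℙ M≡ (altSum≡χ as)
  k≤b : k ≤ b
  k≤b = <⇒≤ (inverse-quotient-< a<b a*<b aa*≡1+kb)
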